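{- In a weakly tree-child $\mathcal{L}$-network, distinct root components have incomparable root $\mu$-vectors.
   Context: A semidirected graph is $N=(V,E)$ with $E=E_U\sqcup E_D$, $E_U$ undirected edges $uv$, $E_D$ directed edges $(u,v)$ ($u$ parent, $v$ child); parallel directed edges allowed, no self-loops. $\deg_i(v,N)$ is the number of directed edges with child $v$. $N'$ is compatible with $N$ if obtained by directing some undirected edges. A semidirected cycle is a semidirected graph whose undirected edges can be directed to make it a directed cycle; acyclic (SDAG) means containing no semidirected cycle; DAG = acyclic directed graph. Tree node: $\deg_i\le1$; hybrid node otherwise. Hybrid edge: directed edge with hybrid child; $E_H(N)$ their set. SDAG $N'$ is phylogenetically compatible with SDAG $N$ if compatible and $E_H(N')=E_H(N)$; a rooted partner of $N$ is a DAG phylogenetically compatible with $N$; a network is an SDAG admitting a rooted partner. In a DAG, a leaf has out-degree 0 and a root has in-degree 0; a DAG is tree-child if every non-leaf node has a child that is a tree node; a network is weakly tree-child if at least one of its rooted partners is tree-child. A rooted leaf is a leaf in every rooted partner, an unrooted leaf a leaf in some rooted partner. For a vector $\mathcal{L}=(\ell_1,\dots,\ell_n)$ of distinct labels, an $\mathcal{L}$-network is a network whose sets of rooted and unrooted leaves coincide and are bijectively labeled by $\mathcal{L}$. For a DAG $G$ with leaves labeled by $\mathcal{L}$, $\mu(v,G)\in\mathbb{Z}_{\ge0}^n$ has $i$-th coordinate the number of directed paths from $v$ to the leaf labeled $\ell_i$; vectors are compared coordinatewise, and two are incomparable if neither is $\le$ the other. A semidirected path from $u_0$ to $u_n$ is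 $u_0\dots u_n$ with $u_{i-1}u_i$ or $(u_{i-1},u_i)$ an edge for each $i$; $v\lesssim u$ if there is a semidirected path from $u$ to $v$; $u\sim v$ if $u\lesssim v$ and $v\lesssim u$. An undirected component is the subgraph induced by a $\sim$-class; a root component is one whose class is maximal under $\lesssim$. A root choice function $\rho$ picks a node $\rho(T)$ in each root component $T$; for each $\rho$ there is a unique rooted partner $N^+_\rho$ whose set of roots is $\{\rho(T)\}$. The root $\mu$-vector of a root component $T$ is $\mu_r(T)=\mu(\rho(T),N^+_\rho)$ for any root choice function $\rho$ (independent of $\rho$). -}

module Defs where

open import Data.Nat using (ℕ; zero; suc; _≤_; _+_)
open import Data.Fin using (Fin; zero; suc; _≟_; splitAt; _↑ˡ_; inject₁; fromℕ)
open import Data.Fin.Subset using (Subset; _∈_)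
open import Data.Product using (_×_; _,_; proj₁; proj₂; Σ; ∃; ∃-syntax; swap)
open import Data.Sum using (_⊎_; inj₁; inj₂; [_,_])
open import Data.Bool using (Bool; true; false; if_then_else_)
open import Data.List using (length; filter; allFin)
open import Function using (_∘_)
open import Function.Bundles using (_↔_; _⇔_)
open import Function.Definitions using (Injective)
open import Relation.Binary.PropositionalEquality using (_≡_; _≢_)
open import Relation.Nullary using (¬_)

-- Undirected edges
-- are indexed by Fin mU (endpoints as a pair, order irrelevant);
-- directed edges by Fin mD as (parent , child).  Edges are identified
-- by their index, so parallel directed edges are distinct edges.

record SDG : Set where
  field
    n     : ℕ
    mU    : ℕ
    mD    : ℕ
    uEdge : Fin mU → Fin n × Fin n
    dEdge : Fin mD → Fin n × Fin n
open SDG public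

parent : (N : SDG) → Fin (mD N) → Fin (n N)
parent N e = proj₁ (dEdge N e)

child : (N : SDG) → Fin (mD N) → Fin (n N)
child N e = proj₂ (dEdge N e)

SameEnds : {A : Set} → A × A → A × A → Set
SameEnds (a , b) (c , d) = (a ≡ c × b ≡ d) ⊎ (a ≡ d × b ≡ c)

-- well-formedness: no self-loops, E_U is a set (no two undirected edges
-- with the same pair of endpoints); parallel directed edges allowed.
IsSDG : SDG → Set
IsSDG N =
  (∀ f → proj₁ (uEdge N f) ≢ proj₂ (uEdge N f)) ×
  (∀ e → parent N e ≢ child N e) ×
  (∀ f g → SameEnds (uEdge N f) (uEdge N g) → f ≡ g)

data Step (N : SDG) : Set where
  dstep : Fin (mD N) → Step N
  ustep : Fin (mU N) → Bool → Step N   -- true: traverse fst→snd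

stepFrom : {N : SDG} → Step N → Fin (n N)
stepFrom {N} (dstep e) = parent N e
stepFrom {N} (ustep f true) = proj₁ (uEdge N f)
stepFrom {N} (ustep f false) = proj₂ (uEdge N f)

stepTo : {N : SDG} → Step N → Fin (n N)
stepTo {N} (dstep e) = child N e
stepTo {N} (ustep f true) = proj₂ (uEdge N f)
stepTo {N} (ustep f false) = proj₁ (uEdge N f)

stepEdge : {N : SDG} → Step N → Fin (mD N) ⊎ Fin (mU N)
stepEdge (dstep e) = inj₁ e
stepEdge (ustep f _) = inj₂ f

SDCycle : SDG → Set
SDCycle N =
  Σ ℕ λ k → Σ (Fin (suc k) → Step N) λ s →
    (∀ (i : Fin k) → stepTo (s (inject₁ i)) ≡ stepFrom (s (suc i))) ×
    (stepTo (s (fromℕ k)) ≡ stepFrom (s zero)) ×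
    Injective _≡_ _≡_ (stepEdge ∘ s) ×
    Injective _≡_ _≡_ (stepFrom ∘ s)

Acyclic : SDG → Set
Acyclic N = ¬ SDCycle N

IsSDAG : SDG → Set
IsSDAG N = IsSDG N × Acyclic N

indeg : (N : SDG) → Fin (n N) → ℕ
indeg N v = length (filter (λ e → child N e ≟ v) (allFin (mD N)))

outdeg : (N : SDG) → Fin (n N) → ℕ
outdeg N v = length (filter (λ e → parent N e ≟ v) (allFin (mD N)))

IsHybrid : (N : SDG) → Fin (n N) → Set
IsHybrid N v = 2 ≤ indeg N v

IsTreeNode : (N : SDG) → Fin (n N) → Set
IsTreeNode N v = indeg N v ≤ 1

Orientation : SDG → Set
Orientation N = Fin (mU N) → Bool

orient : (N : SDG) → Orientation N → Fin (mU N) → Fin (n N) × Fin (n N)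
orient N o f = if o f then uEdge N f else swap (uEdge N f)

-- the directed graph obtained from N by directing all undirected edges
-- according to o; directed edge e of N is edge (e ↑ˡ mU N) here,
-- undirected edge f becomes edge (mD N ↑ʳ f).
directed : (N : SDG) → Orientation N → SDG
directed N o = record
  { n = n N
  ; mU = 0
  ; mD = mD N + mU N
  ; uEdge = λ ()
  ; dEdge = [ dEdge N , orient N o ] ∘ splitAt (mD N)
  }

-- rooted partner: a DAG compatible with N with E_H equal to E_H(N)
IsRootedPartner : (N : SDG) → Orientation N → Set
IsRootedPartner N o =
  Acyclic (directed N o) ×
  (∀ (x : Fin (mD N + mU N)) →
     IsHybrid (directed N o) (child (directed N o) x)
       ⇔ (Σ (Fin (mD N)) λ e → (x ≡ e ↑ˡ mU N) × IsHybrid N (child N e)))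

IsNetwork : SDG → Set
IsNetwork N = IsSDAG N × ∃[ o ] IsRootedPartner N o

IsLeafD : (G : SDG) → Fin (n G) → Set
IsLeafD G v = outdeg G v ≡ 0

IsRootD : (G : SDG) → Fin (n G) → Set
IsRootD G v = indeg G v ≡ 0

IsTreeChildDAG : SDG → Set
IsTreeChildDAG G =
  ∀ v → ¬ IsLeafD G v → Σ (Fin (mD G)) λ e → (parent G e ≡ v) × IsTreeNode G (child G e)

WeaklyTreeChild : SDG → Set
WeaklyTreeChild N = ∃[ o ] (IsRootedPartner N o × IsTreeChildDAG (directed N o))

RootedLeaf : (N : SDG) → Fin (n N) → Set
RootedLeaf N v = ∀ o → IsRootedPartner N o → IsLeafD (directed N o) v

UnrootedLeaf : (N : SDG) → Fin (n N) → Set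
UnrootedLeaf N v = ∃[ o ] (IsRootedPartner N o × IsLeafD (directed N o) v)

-- L-network for L = (ℓ_1,…,ℓ_k): the label ℓ_i is identified with its
-- position i; lab i is the leaf carrying ℓ_i.
IsLNetwork : (N : SDG) (k : ℕ) → (Fin k → Fin (n N)) → Set
IsLNetwork N k lab =
  IsNetwork N ×
  (∀ v → RootedLeaf N v ⇔ UnrootedLeaf N v) ×
  Injective _≡_ _≡_ lab ×
  (∀ i → RootedLeaf N (lab i)) ×
  (∀ v → RootedLeaf N v → ∃[ i ] lab i ≡ v)

data SDPath (N : SDG) : Fin (n N) → Fin (n N) → Set where
  here  : ∀ {u} → SDPath N u u
  viaD  : ∀ e {v} → SDPath N (child N e) v → SDPath N (parent N e) v
  viaU₁ : ∀ f {v} → SDPath N (proj₂ (uEdge N f)) v → SDPath N (proj₁ (uEdge N f)) v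
  viaU₂ : ∀ f {v} → SDPath N (proj₁ (uEdge N f)) v → SDPath N (proj₂ (uEdge N f)) v


Below : (N : SDG) → Fin (n N) → Fin (n N) → Set
Below N v u = SDPath N u v

Equiv : (N : SDG) → Fin (n N) → Fin (n N) → Set
Equiv N u v = Below N u v × Below N v u

-- u lies in a root component: its ~-class is maximal under ≲
InRootComponent : (N : SDG) → Fin (n N) → Set
InRootComponent N u = ∀ w → Below N u w → Below N w u

-- a root choice function, given as the set R of chosen nodes: exactly
-- one chosen node in each root component, and none elsewhere
IsRootChoice : (N : SDG) → Subset (n N) → Set
IsRootChoice N R =
  (∀ r → r ∈ R → InRootComponent N r) ×
  (∀ u → InRootComponent N u → ∃[ r ] (r ∈ R × Equiv N r u)) ×
  (∀ r r' → r ∈ R → r' ∈ R → Equiv N r r' → r ≡ r')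

data DPath (G : SDG) : Fin (n G) → Fin (n G) → Set where
  nil  : ∀ v → DPath G v v
  step : ∀ e {w} → DPath G (child G e) w → DPath G (parent G e) w

-- x = μ(v,G): x i is the number of directed paths from v to leaf lab i
IsMu : (G : SDG) {k : ℕ} → (Fin k → Fin (n G)) → Fin (n G) → (Fin k → ℕ) → Set
IsMu G lab v x = ∀ i → DPath G v (lab i) ↔ Fin (x i)

Incomparable : {k : ℕ} → (Fin k → ℕ) → (Fin k → ℕ) → Set
Incomparable x y = ¬ (∀ i → x i ≤ y i) × ¬ (∀ i → y i ≤ x i)

-- Let G be the rooted partner whose roots are R, and G' a tree-child rooted partner.
-- From a root r of G, follow tree edges of G' until a leaf ℓ is reached. Each edge taken
-- has the same direction in G and is the only in-edge of its child there: another one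
-- would either be a second in-edge in G' of a tree node, or an undirected edge of N
-- entering a node that is then hybrid in G, whose in-edges are all directed in N.
-- Hence another root r' can reach ℓ only through r, which it cannot, since distinct
-- roots lie in distinct root components. So μ at r is positive at ℓ and μ at r' is not.
module Submission where

open import Defs
open import Data.Nat using (ℕ)
open import Data.Fin using (Fin)
open import Data.Fin.Subset using (Subset; _∈_)
open import Function.Bundles using (_⇔_)
open import Relation.Binary.PropositionalEquality using (_≢_)

open import Data.Nat using (zero; suc; _≤_; _<_; _+_; z≤n; s≤s; z<s; _≟_; >-nonZero⁻¹)
open import Data.Nat.Properties using (≤-trans; +-mono-≤; m≤n⇒m≤1+n; 1+n≰n)
open import Data.Fin using (zero; suc; splitAt; _↑ˡ_; fromℕ<) renaming (_≟_ to _≟ᶠ_)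
open import Data.Fin.Properties using (splitAt-↑ˡ; injective⇒≤; nonZeroIndex)
open import Data.Vec.Functional using (Vector; _∷_)
open import Data.Product using (_×_; _,_; proj₁; proj₂; Σ; ∃; swap)
open import Data.Sum using (_⊎_; inj₁; inj₂; [_,_])
open import Data.Bool using (true; false)
open import Data.List using (List; filter; allFin) renaming (length to lengthˡ)
open import Data.List.Membership.Propositional using () renaming (_∈_ to _∈ˡ_)
open import Data.List.Membership.Propositional.Properties using (∈-filter⁺; ∈-allFin; ∈-length)
open import Data.List.Relation.Unary.Any using (here; there)
open import Data.Empty using (⊥-elim)
open import Relation.Nullary using (¬_; yes; no)
open import Relation.Binary.PropositionalEquality using (_≡_; refl; sym; trans; cong; subst; subst₂)
open import Function.Bundles using (Equivalence; Inverse)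
open import Function.Base using (_∘_)
open import Function.Definitions using (Injective)

distinct-members⇒length≥2 : {A : Set} {x y : A} {xs : List A} →
  x ∈ˡ xs → y ∈ˡ xs → x ≢ y → 2 ≤ lengthˡ xs
distinct-members⇒length≥2 (here refl) (here refl) x≢y = ⊥-elim (x≢y refl)
distinct-members⇒length≥2 (here refl) (there y∈) _   = s≤s (∈-length y∈)
distinct-members⇒length≥2 (there x∈) (here refl) _   = s≤s (∈-length x∈)
distinct-members⇒length≥2 (there x∈) (there y∈) x≢y = m≤n⇒m≤1+n (distinct-members⇒length≥2 x∈ y∈ x≢y)

∷-injective : {A : Set} {m : ℕ} {w : A} {f : Vector A m} →
  (∀ i → f i ≢ w) → Injective _≡_ _≡_ f → Injective _≡_ _≡_ (w ∷ f)
∷-injective _     _     {zero}  {zero}  _  = refl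
∷-injective fresh _     {zero}  {suc j} eq = ⊥-elim (fresh j (sym eq))
∷-injective fresh _     {suc i} {zero}  eq = ⊥-elim (fresh i eq)
∷-injective _     f-inj {suc i} {suc j} eq = cong suc (f-inj eq)

module _ (G : SDG) where

  in-edge∈ : ∀ {e v} → child G e ≡ v → e ∈ˡ filter (λ d → child G d ≟ᶠ v) (allFin (mD G))
  in-edge∈ {e} = ∈-filter⁺ (λ d → child G d ≟ᶠ _) (∈-allFin e)

  root⇒no-in-edge : ∀ {e v} → IsRootD G v → child G e ≢ v
  root⇒no-in-edge root ce with ∈-length (in-edge∈ ce)
  ... | pos rewrite root = 1+n≰n pos

  distinct-in-edges⇒hybrid : ∀ {d e v} → d ≢ e → child G d ≡ v → child G e ≡ v → IsHybrid G v
  distinct-in-edges⇒hybrid d≢e cd ce = distinct-members⇒length≥2 (in-edge∈ cd) (in-edge∈ ce) d≢e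

  tree-node⇒in-edge-unique : ∀ {d e v} → IsTreeNode G v → child G d ≡ v → child G e ≡ v → d ≡ e
  tree-node⇒in-edge-unique {d} {e} tree cd ce with d ≟ᶠ e
  ... | yes d≡e = d≡e
  ... | no d≢e  = ⊥-elim (1+n≰n (≤-trans (distinct-in-edges⇒hybrid d≢e cd ce) tree))

module _ {G : SDG} where

  length : ∀ {a b} → DPath G a b → ℕ
  length (nil _)    = 0
  length (step _ p) = suc (length p)

  infixr 5 _++_
  _++_ : ∀ {a b c} → DPath G a b → DPath G b c → DPath G a c
  nil _    ++ q = q
  step e p ++ q = step e (p ++ q)

  length-++ : ∀ {a b c} (p : DPath G a b) (q : DPath G b c) → length (p ++ q) ≡ length p + length q
  length-++ (nil _)    q = refl
  length-++ (step e p) q = cong suc (length-++ p q)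

  repeat : ∀ {a} → DPath G a a → ℕ → DPath G a a
  repeat c zero    = nil _
  repeat c (suc k) = c ++ repeat c k

  length-repeat : ∀ {a} (c : DPath G a a) → 0 < length c → ∀ k → k ≤ length (repeat c k)
  length-repeat c pos zero    = z≤n
  length-repeat c pos (suc k) rewrite length-++ c (repeat c k) = +-mono-≤ pos (length-repeat c pos k)

  last-edge : ∀ {a b} (p : DPath G a b) →
    (a ≡ b × length p ≡ 0) ⊎
    Σ (Fin (mD G)) λ d → Σ (DPath G a (parent G d)) λ q → child G d ≡ b × length p ≡ suc (length q)
  last-edge (nil _) = inj₁ (refl , refl)
  last-edge (step e p) with last-edge p
  ... | inj₁ (refl , eq)       = inj₂ (e , nil _ , refl , cong suc eq)
  ... | inj₂ (d , q , cd , eq) = inj₂ (d , step e q , cd , cong suc eq)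

InPathsBounded : (G : SDG) → Fin (n G) → ℕ → Set
InPathsBounded G v j = ∀ {u} (p : DPath G u v) → length p ≤ j

in-paths-bounded⇒no-cycle : ∀ {G a j} → InPathsBounded G a j → (c : DPath G a a) → ¬ (0 < length c)
in-paths-bounded⇒no-cycle {j = j} bounded c pos =
  1+n≰n (≤-trans (length-repeat c pos (suc j)) (bounded (repeat c (suc j))))

module _ (N : SDG) where

  private
    oriented-edge : Orientation N → Fin (mD N) ⊎ Fin (mU N) → Fin (n N) × Fin (n N)
    oriented-edge o = [ dEdge N , orient N o ]

    oriented-edge-loopless : IsSDG N → ∀ o s → proj₁ (oriented-edge o s) ≢ proj₂ (oriented-edge o s)
    oriented-edge-loopless (_ , d-loopless , _) o (inj₁ e) = d-loopless e
    oriented-edge-loopless (u-loopless , _) o (inj₂ f) with o f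
    ... | true  = u-loopless f
    ... | false = u-loopless f ∘ sym

    agree-or-reversed : ∀ o o' s → oriented-edge o s ≡ oriented-edge o' s ⊎
      (oriented-edge o s ≡ swap (oriented-edge o' s) × ∃ λ f → s ≡ inj₂ f)
    agree-or-reversed o o' (inj₁ e) = inj₁ refl
    agree-or-reversed o o' (inj₂ f) with o f | o' f
    ... | true  | true  = inj₁ refl
    ... | false | false = inj₁ refl
    ... | true  | false = inj₂ (refl , f , refl)
    ... | false | true  = inj₂ (refl , f , refl)

    oriented-step : ∀ o s {b} → SDPath N (proj₂ (oriented-edge o s)) b → SDPath N (proj₁ (oriented-edge o s)) b
    oriented-step o (inj₁ e) = viaD e
    oriented-step o (inj₂ f) with o f
    ... | true  = viaU₁ f
    ... | false = viaU₂ f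

  directed-loopless : IsSDG N → ∀ o x → parent (directed N o) x ≢ child (directed N o) x
  directed-loopless sdg o x = oriented-edge-loopless sdg o (splitAt (mD N) x)

  directed-agree-or-reversed : ∀ o o' x →
    dEdge (directed N o) x ≡ dEdge (directed N o') x ⊎
    (dEdge (directed N o) x ≡ swap (dEdge (directed N o') x) × ∀ e → x ≢ e ↑ˡ mU N)
  directed-agree-or-reversed o o' x with agree-or-reversed o o' (splitAt (mD N) x)
  ... | inj₁ same                   = inj₁ same
  ... | inj₂ (reversed , f , split) = inj₂ (reversed , not-directed)
    where
      not-directed : ∀ e → x ≢ e ↑ˡ mU N
      not-directed e refl with trans (sym (splitAt-↑ˡ (mD N) e (mU N))) split
      ... | ()

  directed-path⇒semidirected : ∀ {o a b} → DPath (directed N o) a b → SDPath N a b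
  directed-path⇒semidirected {o} (nil _)    = here
  directed-path⇒semidirected {o} (step x p) = oriented-step o (splitAt (mD N) x) (directed-path⇒semidirected p)

distinct-roots-unreachable : ∀ {N R r r'} → IsRootChoice N R →
  r ∈ R → r' ∈ R → r ≢ r' → ¬ SDPath N r' r
distinct-roots-unreachable (in-root-component , _ , unique) r∈R r'∈R r≢r' p =
  r≢r' (unique _ _ r∈R r'∈R (p , in-root-component _ r∈R _ p))

module Separation
  (N : SDG) (sdg : IsSDG N) (o o' : Orientation N)
  (hybrids-directed : ∀ x → IsHybrid (directed N o) (child (directed N o) x) → ∃ λ e → x ≡ e ↑ˡ mU N)
  (tree-child : IsTreeChildDAG (directed N o'))
  {r r' : Fin (n N)} (r-root : IsRootD (directed N o) r) (r'-root : IsRootD (directed N o) r')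
  (r'↛r : ¬ DPath (directed N o) r' r)
  where

  G G' : SDG
  G  = directed N o
  G' = directed N o'

  -- The bound on in-path lengths stands in for the acyclicity of G: it forbids
  -- returning to a visited node, so the walk stops at a leaf within n N steps.
  record Walk (j : ℕ) : Set where
    field
      end               : Fin (n N)
      from-r            : DPath G r end
      not-from-r'       : ¬ DPath G r' end
      in-edges-agree    : ∀ d → child G d ≡ end → child G' d ≡ end
      in-paths-bounded  : InPathsBounded G end j
      visited           : Vector (Fin (n N)) (suc j)
      visited-injective : Injective _≡_ _≡_ visited
      visited-reach-end : ∀ i → DPath G (visited i) end
  open Walk

  SeparatingLeaf : Set
  SeparatingLeaf = Σ (Fin (n N)) λ ℓ → IsLeafD G' ℓ × DPath G r ℓ × ¬ DPath G r' ℓ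

  start : Walk 0
  start = record
    { end               = r
    ; from-r            = nil r
    ; not-from-r'       = r'↛r
    ; in-edges-agree    = λ d cd → ⊥-elim (root⇒no-in-edge G r-root cd)
    ; in-paths-bounded  = bounded
    ; visited           = λ _ → r
    ; visited-injective = λ { {zero} {zero} _ → refl }
    ; visited-reach-end = λ _ → nil r
    }
    where
      bounded : InPathsBounded G r 0
      bounded p with last-edge p
      ... | inj₁ (_ , empty)      = subst (_≤ 0) (sym empty) z≤n
      ... | inj₂ (_ , _ , cd , _) = ⊥-elim (root⇒no-in-edge G r-root cd)

  module TreeEdge {j} (W : Walk j) (e : Fin (mD G'))
    (e-from-end : parent G' e ≡ end W) (tree : IsTreeNode G' (child G' e)) where

    v w : Fin (n N)
    v = end W
    w = child G' e

    e-agrees : parent G e ≡ v × child G e ≡ w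
    e-agrees with directed-agree-or-reversed N o o' e
    ... | inj₁ same           = trans (cong proj₁ same) e-from-end , cong proj₂ same
    ... | inj₂ (reversed , _) = ⊥-elim (directed-loopless N sdg o' e
            (trans e-from-end (sym (in-edges-agree W e (trans (cong proj₂ reversed) e-from-end)))))

    v→w : DPath G v w
    v→w = subst₂ (DPath G) (proj₁ e-agrees) (proj₂ e-agrees) (step e (nil _))

    only-in-edge : ∀ d → child G d ≡ w → d ≡ e
    only-in-edge d cd with directed-agree-or-reversed N o o' d
    ... | inj₁ same = tree-node⇒in-edge-unique G' tree (trans (sym (cong proj₂ same)) cd) refl
    ... | inj₂ (_ , not-directed) with d ≟ᶠ e
    ...   | yes d≡e = d≡e
    ...   | no d≢e with hybrids-directed d (subst (IsHybrid G) (sym cd)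
                         (distinct-in-edges⇒hybrid G d≢e cd (proj₂ e-agrees)))
    ...     | (d₀ , d≡d₀) = ⊥-elim (not-directed d₀ d≡d₀)

    paths-into-w : ∀ {u} (p : DPath G u w) →
      (u ≡ w × length p ≡ 0) ⊎ Σ (DPath G u (parent G e)) λ q → length p ≡ suc (length q)
    paths-into-w p with last-edge p
    ... | inj₁ empty = inj₁ empty
    ... | inj₂ (d , q , cd , eq) with only-in-edge d cd
    ...   | refl = inj₂ (q , eq)

    parent-bounded : InPathsBounded G (parent G e) j
    parent-bounded = subst (λ a → InPathsBounded G a j) (sym (proj₁ e-agrees)) (in-paths-bounded W)

    w↛v : ¬ DPath G w v
    w↛v p = in-paths-bounded⇒no-cycle parent-bounded
      (step e (subst₂ (DPath G) (sym (proj₂ e-agrees)) (sym (proj₁ e-agrees)) p)) z<s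

    not-from-r'-to-w : ¬ DPath G r' w
    not-from-r'-to-w p with paths-into-w p
    ... | inj₁ (r'≡w , _) = root⇒no-in-edge G r'-root (trans (proj₂ e-agrees) (sym r'≡w))
    ... | inj₂ (q , _)    = not-from-r' W (subst (DPath G r') (proj₁ e-agrees) q)

    w-bounded : InPathsBounded G w (suc j)
    w-bounded p with paths-into-w p
    ... | inj₁ (_ , empty) = subst (_≤ suc j) (sym empty) z≤n
    ... | inj₂ (q , eq)    = subst (_≤ suc j) (sym eq) (s≤s (parent-bounded q))

    next : Walk (suc j)
    next = record
      { end               = w
      ; from-r            = from-r W ++ v→w
      ; not-from-r'       = not-from-r'-to-w
      ; in-edges-agree    = λ d cd → subst (λ d → child G' d ≡ w) (sym (only-in-edge d cd)) refl
      ; in-paths-bounded  = w-bounded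
      ; visited           = w ∷ visited W
      ; visited-injective = ∷-injective (λ i eq → w↛v (subst (λ a → DPath G a v) eq (visited-reach-end W i)))
                                         (visited-injective W)
      ; visited-reach-end = λ { zero → nil w ; (suc i) → visited-reach-end W i ++ v→w }
      }

  extend : ∀ {j} → Walk j → SeparatingLeaf ⊎ Walk (suc j)
  extend W with outdeg G' (end W) ≟ 0
  ... | yes leaf = inj₁ (end W , leaf , from-r W , not-from-r' W)
  ... | no non-leaf with tree-child (end W) non-leaf
  ...   | (e , e-from-end , tree) = inj₂ (TreeEdge.next W e e-from-end tree)

  walk : ∀ j → SeparatingLeaf ⊎ Walk j
  walk zero    = inj₂ start
  walk (suc j) with walk j
  ... | inj₁ found = inj₁ found
  ... | inj₂ W     = extend W

  separating-leaf : SeparatingLeaf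
  separating-leaf with walk (n N)
  ... | inj₁ found = found
  ... | inj₂ W     = ⊥-elim (1+n≰n (injective⇒≤ (visited-injective W)))

module _ {G : SDG} {k : ℕ} {lab : Fin k → Fin (n G)} where

  path⇔mu-positive : ∀ {v x} → IsMu G lab v x → ∀ i → DPath G v (lab i) ⇔ 0 < x i
  path⇔mu-positive μ i = record
    { to        = λ p → >-nonZero⁻¹ _ {{nonZeroIndex (Inverse.to (μ i) p)}}
    ; from      = λ pos → Inverse.from (μ i) (fromℕ< pos)
    ; to-cong   = cong _
    ; from-cong = cong _
    }

  separated⇒not-below : ∀ {a b x y i} → IsMu G lab a x → IsMu G lab b y →
    DPath G a (lab i) → ¬ DPath G b (lab i) → ¬ (∀ i → x i ≤ y i)
  separated⇒not-below {i = i} μa μb a→ℓ b↛ℓ x≤y =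
    b↛ℓ (Equivalence.from (path⇔mu-positive μb i)
          (≤-trans (Equivalence.to (path⇔mu-positive μa i) a→ℓ) (x≤y i)))

proposition13 : (N : SDG) (k : ℕ) (lab : Fin k → Fin (n N)) →
    IsLNetwork N k lab → WeaklyTreeChild N →
    (R : Subset (n N)) → IsRootChoice N R →
    (o : Orientation N) → IsRootedPartner N o →
    (∀ v → IsRootD (directed N o) v ⇔ v ∈ R) →
    ∀ r r' → r ∈ R → r' ∈ R → r ≢ r' →
    ∀ x y → IsMu (directed N o) lab r x → IsMu (directed N o) lab r' y →
    Incomparable x y
proposition13 N k lab ((sdag , _) , leaves , _ , _ , labelled) (o' , partner' , tree-child)
  R choice o (_ , hybrids) roots r r' r∈R r'∈R r≢r' x y μr μr' =
    not-below r∈R r'∈R r≢r' μr μr' , not-below r'∈R r∈R (r≢r' ∘ sym) μr' μr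
  where
    G : SDG
    G = directed N o

    root : ∀ {a} → a ∈ R → IsRootD G a
    root a∈R = Equivalence.from (roots _) a∈R

    not-below : ∀ {a b xa xb} → a ∈ R → b ∈ R → a ≢ b →
      IsMu G lab a xa → IsMu G lab b xb → ¬ (∀ i → xa i ≤ xb i)
    not-below a∈R b∈R a≢b μa μb
      with Separation.separating-leaf N (proj₁ sdag) o o'
             (λ x hybrid → let (e , x≡e , _) = Equivalence.to (hybrids x) hybrid in e , x≡e)
             tree-child (root a∈R) (root b∈R)
             (distinct-roots-unreachable choice a∈R b∈R a≢b ∘ directed-path⇒semidirected N)
    ... | (ℓ , leaf , a→ℓ , b↛ℓ)
      with labelled ℓ (Equivalence.from (leaves ℓ) (o' , partner' , leaf))
    ...   | (_ , refl) = separated⇒not-below μa μb a→ℓ b↛ℓ
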